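{- For a finite set $X$ let $\mathscr{T}\mathit{opo}[X]$ be the set of topologies on $X$ and $\mathbf{Topo}[X]$ the vector space it spans. For disjoint finite sets $X,Y$ define $m_{X,Y}(\mathcal{O}_X\otimes\mathcal{O}_Y)=\{I\sqcup J\mid I\in\mathcal{O}_X,\ J\in\mathcal{O}_Y\}$ and, for $\mathcal{O}\in\mathscr{T}\mathit{opo}[X\sqcup Y]$, $\Delta_{X,Y}(\mathcal{O})=\mathcal{O}_{\mid X}\otimes\mathcal{O}_{\mid Y}$ if $Y\in\mathcal{O}$ and $0$ otherwise, where $\mathcal{O}_{\mid Z}=\{O\cap Z\mid O\in\mathcal{O}\}$. Then $\mathbf{Topo}$ is a twisted bialgebra, and the map $\Upsilon:\mathbf{G}\to\mathbf{Topo}$ sending a mixed graph $G\in\mathscr{G}[X]$ to the set $\mathcal{O}[G]$ of its ideals (a topology on $X$) is a surjective morphism of twisted bialgebras.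
   Context: A mixed graph $G$ has a finite vertex set $V(G)$, a set $E(G)$ of edges (2-element subsets) and a set $A(G)$ of arcs (ordered pairs of distinct vertices), no pair being both an edge and carrying an arc. $\mathscr{G}[X]$ is the set of mixed graphs with vertex set $X$, $\mathbf{G}[X]$ its span. $I\subseteq V(G)$ is an ideal if $x\in I$ and $(x,y)\in A(G)$ imply $y\in I$. The twisted bialgebra $\mathbf{G}$ has product the disjoint union and coproduct $\Delta_{X,Y}(G)=G_{\mid X}\otimes G_{\mid Y}$ if $Y$ is an ideal of $G$, $0$ otherwise ($G_{\mid Z}$ the induced mixed graph). A twisted bialgebra is a bialgebra in the category of species with the Cauchy tensor product. -}

module Defs where

open import Level using (Level; 0ℓ) renaming (suc to lsuc)
open import Data.Nat using (ℕ)
open import Data.Fin using (Fin)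
open import Data.Fin.Subset using (Subset; _∈_; _∉_; _⊆_; _∪_; _∩_; ⊥)
open import Data.Fin.Permutation as P using (Permutation′; _⟨$⟩ˡ_; _∘ₚ_)
open import Data.Vec using (Vec; []; _∷_; tabulate; lookup)
open import Data.Bool using (Bool; true; false; _∧_; _∨_; not; if_then_else_)
open import Data.Fin using (zero; suc)
open import Data.Maybe using (Maybe; just; nothing; _>>=_) renaming (map to mapᴹ)
open import Data.Product using (Σ; ∃; ∃₂; _×_; _,_)
open import Function.Bundles using (_⇔_)
open import Relation.Binary.PropositionalEquality using (_≡_; _≢_)

-- A finite set is modelled as a subset of an ambient
-- Fin n (every finite set is in bijection with such a subset, and every
-- bijection between two such subsets extends to a permutation of Fin n).
-- Disjoint union of X and Y is X ∪ Y with X ∩ Y ≡ ⊥.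

Disj : ∀ {n} → Subset n → Subset n → Set
Disj X Y = X ∩ Y ≡ ⊥

image : ∀ {n} → Permutation′ n → Subset n → Subset n
image π S = tabulate (λ i → lookup S (π ⟨$⟩ˡ i))

-- Both G and Topo have a basis (mixed graphs, topologies) on which the
-- product sends basis⊗basis to a basis element, the coproduct sends a
-- basis element to 0 or to basis⊗basis, and the species action sends
-- basis to basis.  Hence all structure maps are the linear extensions of
-- the maps below (Maybe: nothing = 0), and the axioms of a twisted
-- bialgebra hold iff they hold on basis elements, which is what
-- IsTwistedBialgebra states.

record TwistedStr (n : ℕ) : Set₂ where
  field
    Obj     : Set₁
    Valid   : Obj → Set                 -- is a genuine basis element
    supp    : Obj → Subset n
    _≈_     : Obj → Obj → Set
    relabel : Permutation′ n → Obj → Obj  -- species action (transport)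
    one     : Obj
    mul     : Obj → Obj → Obj
    cop     : Subset n → Subset n → Obj → Maybe (Obj × Obj)

Lift₂ : {A : Set₁} → (A → A → Set) → Maybe (A × A) → Maybe (A × A) → Set
Lift₂ R nothing nothing = Data.Unit.⊤ where import Data.Unit
Lift₂ R nothing (just _) = Data.Empty.⊥ where import Data.Empty
Lift₂ R (just _) nothing = Data.Empty.⊥ where import Data.Empty
Lift₂ R (just (a , b)) (just (c , d)) = R a c × R b d

Lift₃ : {A : Set₁} → (A → A → Set) → Maybe (A × A × A) → Maybe (A × A × A) → Set
Lift₃ R nothing nothing = Data.Unit.⊤ where import Data.Unit
Lift₃ R nothing (just _) = Data.Empty.⊥ where import Data.Empty
Lift₃ R (just _) nothing = Data.Empty.⊥ where import Data.Empty
Lift₃ R (just (a , b , c)) (just (d , e , f)) = R a d × R b e × R c f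

module _ {n : ℕ} (S : TwistedStr n) where
  open TwistedStr S

  -- (m ⊗ m) ∘ (id ⊗ τ ⊗ id) on (0 or pair) ⊗ (0 or pair)
  combine : Maybe (Obj × Obj) → Maybe (Obj × Obj) → Maybe (Obj × Obj)
  combine (just (a₁ , a₂)) (just (b₁ , b₂)) = just (mul a₁ b₁ , mul a₂ b₂)
  combine _ _ = nothing

  -- (Δ_{X,Y} ⊗ id) ∘ Δ_{X⊔Y,Z}
  copˡ : Subset n → Subset n → Subset n → Obj → Maybe (Obj × Obj × Obj)
  copˡ X Y Z a = cop (X ∪ Y) Z a >>= λ { (b , c) → mapᴹ (λ { (d , e) → (d , e , c) }) (cop X Y b) }

  -- (id ⊗ Δ_{Y,Z}) ∘ Δ_{X,Y⊔Z}
  copʳ : Subset n → Subset n → Subset n → Obj → Maybe (Obj × Obj × Obj)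
  copʳ X Y Z a = cop X (Y ∪ Z) a >>= λ { (b , c) → mapᴹ (λ { (d , e) → (b , d , e) }) (cop Y Z c) }

  -- The counit is ε_∅(1) = 1 and ε_X = 0 for X ≠ ∅ (the species is
  -- connected: the unique basis element on ∅ is `one`).
  record IsTwistedBialgebra : Set₁ where
    field
      one-valid   : Valid one
      one-supp    : supp one ≡ ⊥
      mul-valid   : ∀ a b → Valid a → Valid b → Disj (supp a) (supp b) →
                    Valid (mul a b) × supp (mul a b) ≡ supp a ∪ supp b
      cop-valid   : ∀ a X Y → Valid a → Disj X Y → X ∪ Y ≡ supp a →
                    ∀ b c → cop X Y a ≡ just (b , c) →
                    Valid b × Valid c × supp b ≡ X × supp c ≡ Y
      relabel-valid : ∀ π a → Valid a →
                    Valid (relabel π a) × supp (relabel π a) ≡ image π (supp a)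
      relabel-id  : ∀ a → Valid a → relabel P.id a ≈ a
      relabel-∘   : ∀ π σ a → Valid a → relabel (π ∘ₚ σ) a ≈ relabel σ (relabel π a)
      one-nat     : ∀ π → relabel π one ≈ one
      mul-nat     : ∀ π a b → Valid a → Valid b → Disj (supp a) (supp b) →
                    relabel π (mul a b) ≈ mul (relabel π a) (relabel π b)
      cop-nat     : ∀ π a X Y → Valid a → Disj X Y → X ∪ Y ≡ supp a →
                    Lift₂ _≈_ (cop (image π X) (image π Y) (relabel π a))
                              (mapᴹ (λ { (b , c) → (relabel π b , relabel π c) }) (cop X Y a))
      mul-assoc   : ∀ a b c → Valid a → Valid b → Valid c →
                    Disj (supp a) (supp b) → Disj (supp a) (supp c) → Disj (supp b) (supp c) →
                    mul (mul a b) c ≈ mul a (mul b c)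
      mul-unitˡ   : ∀ a → Valid a → mul one a ≈ a
      mul-unitʳ   : ∀ a → Valid a → mul a one ≈ a
      cop-coassoc : ∀ a X Y Z → Valid a → Disj X Y → Disj X Z → Disj Y Z →
                    (X ∪ Y) ∪ Z ≡ supp a →
                    Lift₃ _≈_ (copˡ X Y Z a) (copʳ X Y Z a)
      cop-counitˡ : ∀ a → Valid a → Lift₂ _≈_ (cop ⊥ (supp a) a) (just (one , a))
      cop-counitʳ : ∀ a → Valid a → Lift₂ _≈_ (cop (supp a) ⊥ a) (just (a , one))
      cop-one     : Lift₂ _≈_ (cop ⊥ ⊥ one) (just (one , one))
      cop-mul     : ∀ a b X Y → Valid a → Valid b → Disj (supp a) (supp b) →
                    Disj X Y → X ∪ Y ≡ supp a ∪ supp b →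
                    Lift₂ _≈_ (cop X Y (mul a b))
                              (combine (cop (X ∩ supp a) (Y ∩ supp a) a)
                                       (cop (X ∩ supp b) (Y ∩ supp b) b))
  -- (ε ∘ m = ε ⊗ ε and ε ∘ relabel = ε hold automatically from the
  --  support equations above, since ε only depends on supp.)

record IsMorphism {n : ℕ} (S T : TwistedStr n)
                  (f : TwistedStr.Obj S → TwistedStr.Obj T) : Set₁ where
  private
    module S = TwistedStr S
    module T = TwistedStr T
  field
    f-valid   : ∀ a → S.Valid a → T.Valid (f a) × T.supp (f a) ≡ S.supp a
    f-relabel : ∀ π a → S.Valid a → f (S.relabel π a) T.≈ T.relabel π (f a)
    f-one     : f S.one T.≈ T.one
    f-mul     : ∀ a b → S.Valid a → S.Valid b → Disj (S.supp a) (S.supp b) →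
                f (S.mul a b) T.≈ T.mul (f a) (f b)
    f-cop     : ∀ a X Y → S.Valid a → Disj X Y → X ∪ Y ≡ S.supp a →
                Lift₂ T._≈_ (T.cop X Y (f a))
                            (mapᴹ (λ { (b , c) → (f b , f c) }) (S.cop X Y a))

-- surjectivity on basis elements (equivalent to surjectivity of the
-- linear extension, since f maps basis elements to basis elements)
IsSurjective : {n : ℕ} (S T : TwistedStr n)
               (f : TwistedStr.Obj S → TwistedStr.Obj T) → Set₁
IsSurjective S T f = ∀ t → TwistedStr.Valid T t →
  Σ (TwistedStr.Obj S) λ s → TwistedStr.Valid S s × TwistedStr._≈_ T (f s) t

allFinᵇ : ∀ {n} → (Fin n → Bool) → Bool
allFinᵇ {ℕ.zero}  p = true
allFinᵇ {ℕ.suc n} p = p zero ∧ allFinᵇ (λ i → p (suc i))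

anySubsetᵇ : ∀ {n} → (Subset n → Bool) → Bool
anySubsetᵇ {ℕ.zero}  p = p []
anySubsetᵇ {ℕ.suc n} p = anySubsetᵇ (λ s → p (true ∷ s)) ∨ anySubsetᵇ (λ s → p (false ∷ s))

_≡ᵇ_ : Bool → Bool → Bool
true  ≡ᵇ b = b
false ≡ᵇ b = not b

_≟ˢ_ : ∀ {n} → Subset n → Subset n → Bool
S ≟ˢ S′ = allFinᵇ (λ i → lookup S i ≡ᵇ lookup S′ i)

_⊆ᵇ_ : ∀ {n} → Subset n → Subset n → Bool
S ⊆ᵇ S′ = allFinᵇ (λ i → not (lookup S i) ∨ lookup S′ i)

record RawTopo (n : ℕ) : Set₁ where
  field
    pts   : Subset n
    opens : Subset n → Bool
open RawTopo public

-- 𝒪 is a topology on the finite set X (finite: binary unions/intersections)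
IsTopology : ∀ {n} → RawTopo n → Set
IsTopology {n} T =
  (∀ O → opens T O ≡ true → O ⊆ pts T) ×
  opens T ⊥ ≡ true × opens T (pts T) ≡ true ×
  (∀ O O′ → opens T O ≡ true → opens T O′ ≡ true → opens T (O ∪ O′) ≡ true) ×
  (∀ O O′ → opens T O ≡ true → opens T O′ ≡ true → opens T (O ∩ O′) ≡ true)

_≈ᵀ_ : ∀ {n} → RawTopo n → RawTopo n → Set
T ≈ᵀ T′ = pts T ≡ pts T′ × (∀ O → opens T O ≡ opens T′ O)

restrictᵀ : ∀ {n} → Subset n → RawTopo n → RawTopo n
restrictᵀ Z T = record
  { pts = pts T ∩ Z
  ; opens = λ S → anySubsetᵇ (λ O → opens T O ∧ (S ≟ˢ (O ∩ Z))) }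

mulᵀ : ∀ {n} → RawTopo n → RawTopo n → RawTopo n
mulᵀ T T′ = record
  { pts = pts T ∪ pts T′
  ; opens = λ S → anySubsetᵇ (λ I → anySubsetᵇ (λ J →
                    opens T I ∧ opens T′ J ∧ (S ≟ˢ (I ∪ J)))) }

oneᵀ : ∀ {n} → RawTopo n
oneᵀ = record { pts = ⊥ ; opens = λ S → S ≟ˢ ⊥ }

copᵀ : ∀ {n} → Subset n → Subset n → RawTopo n → Maybe (RawTopo n × RawTopo n)
copᵀ X Y T = if opens T Y then just (restrictᵀ X T , restrictᵀ Y T) else nothing

relabelᵀ : ∀ {n} → Permutation′ n → RawTopo n → RawTopo n
relabelᵀ π T = record
  { pts = image π (pts T)
  ; opens = λ S → opens T (tabulate (λ i → lookup S (π P.⟨$⟩ʳ i))) }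

Topo : (n : ℕ) → TwistedStr n
Topo n = record
  { Obj = RawTopo n ; Valid = IsTopology ; supp = pts ; _≈_ = _≈ᵀ_
  ; relabel = relabelᵀ ; one = oneᵀ ; mul = mulᵀ ; cop = copᵀ }

record RawGraph (n : ℕ) : Set₁ where
  field
    V : Subset n
    E : Fin n → Fin n → Bool
    A : Fin n → Fin n → Bool
open RawGraph public

IsMixedGraph : ∀ {n} → RawGraph n → Set
IsMixedGraph G =
  (∀ x y → E G x y ≡ E G y x) ×
  (∀ x y → E G x y ≡ true → x ∈ V G × y ∈ V G × x ≢ y) ×
  (∀ x y → A G x y ≡ true → x ∈ V G × y ∈ V G × x ≢ y) ×
  (∀ x y → E G x y ≡ true → A G x y ≡ false)

_≈ᴳ_ : ∀ {n} → RawGraph n → RawGraph n → Set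
G ≈ᴳ H = V G ≡ V H × (∀ x y → E G x y ≡ E H x y) × (∀ x y → A G x y ≡ A H x y)

isIdealᵇ : ∀ {n} → RawGraph n → Subset n → Bool
isIdealᵇ G I = (I ⊆ᵇ V G) ∧
  allFinᵇ (λ x → allFinᵇ (λ y → not (lookup I x ∧ A G x y) ∨ lookup I y))

restrictᴳ : ∀ {n} → Subset n → RawGraph n → RawGraph n
restrictᴳ Z G = record
  { V = V G ∩ Z
  ; E = λ x y → E G x y ∧ lookup Z x ∧ lookup Z y
  ; A = λ x y → A G x y ∧ lookup Z x ∧ lookup Z y }

mulᴳ : ∀ {n} → RawGraph n → RawGraph n → RawGraph n
mulᴳ G H = record
  { V = V G ∪ V H ; E = λ x y → E G x y ∨ E H x y ; A = λ x y → A G x y ∨ A H x y }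

oneᴳ : ∀ {n} → RawGraph n
oneᴳ = record { V = ⊥ ; E = λ _ _ → false ; A = λ _ _ → false }

copᴳ : ∀ {n} → Subset n → Subset n → RawGraph n → Maybe (RawGraph n × RawGraph n)
copᴳ X Y G = if isIdealᵇ G Y then just (restrictᴳ X G , restrictᴳ Y G) else nothing

relabelᴳ : ∀ {n} → Permutation′ n → RawGraph n → RawGraph n
relabelᴳ π G = record
  { V = image π (V G)
  ; E = λ x y → E G (π ⟨$⟩ˡ x) (π ⟨$⟩ˡ y)
  ; A = λ x y → A G (π ⟨$⟩ˡ x) (π ⟨$⟩ˡ y) }

Gr : (n : ℕ) → TwistedStr n
Gr n = record
  { Obj = RawGraph n ; Valid = IsMixedGraph ; supp = V ; _≈_ = _≈ᴳ_
  ; relabel = relabelᴳ ; one = oneᴳ ; mul = mulᴳ ; cop = copᴳ }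

Υ : ∀ {n} → RawGraph n → RawTopo n
Υ G = record { pts = V G ; opens = isIdealᵇ G }

{-# OPTIONS --safe #-}
module Submission where

-- Each structure map of Topo is described by its open sets: the opens of 𝒪 ⊗ 𝒪′ are the
-- unions I ∪ J, those of 𝒪_{|Z} the traces O ∩ Z, those of a relabelled topology the images.  Every
-- axiom thus reduces to a Boolean identity between subsets plus the agreement of the conditions
-- Y ∈ 𝒪 on both sides: for coassociativity, Z is open and Y is open in 𝒪_{|X⊔Y} iff Y ⊔ Z is open
-- and Z is open in 𝒪_{|Y⊔Z}; for compatibility with the product, Y is open in 𝒪 ⊗ 𝒪′ iff its traces
-- on both factors are.  Ideals of mixed graphs behave in the same way under disjoint union,
-- restriction and relabelling, so Υ is a morphism.  It is surjective because a finite topology is the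
-- topology of ideals of its specialisation graph, with an arc x → y whenever y lies in the smallest
-- open set U_x containing x: an ideal S contains U_x for every x ∈ S, hence is the open set ⋃ U_x.

open import Defs
open import Data.Nat using (ℕ)
open import Data.Product using (_×_)

open import Data.Bool using (Bool; true; false; _∧_; _∨_; not; if_then_else_)
open import Data.Bool.Properties using (∨-zeroʳ; ⇔→≡)
open import Data.Empty using (⊥-elim) renaming (⊥ to Empty)
open import Data.Fin using (Fin; zero; suc)
open import Data.Fin.Properties using (_≟_)
open import Data.Fin.Subset using (Subset; _∈_; _⊆_; _∪_; _∩_; ⊥)
open import Data.Fin.Subset.Properties
  using (⊆-antisym; ⊆-refl; ⊆-reflexive; ⊆-trans; ⊥⊆; ∉⊥; x∈p∪q⁺; x∈p∪q⁻; x∈p∩q⁺; x∈p∩q⁻;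
         p∩q⊆p; p∩q⊆q; p⊆p∪q; q⊆p∪q; ∪-idem; ∩-idem; ∩-zeroˡ; ∩-zeroʳ; ∩-comm;
         ∪-assoc; ∪-identityˡ; ∪-identityʳ; ∩-distribˡ-∪; ∩-distribʳ-∪)
open import Data.Fin.Permutation as Perm
  using (Permutation′; _⟨$⟩ˡ_; _⟨$⟩ʳ_; _∘ₚ_; inverseˡ; inverseʳ)
open import Data.List using (List; []; _∷_)
open import Data.List.Relation.Unary.All using (All; []; _∷_)
open import Data.Maybe using (just) renaming (map to mapᴹ)
open import Data.Product using (∃; ∃₂; _,_; proj₁; proj₂)
open import Data.Sum using (_⊎_; inj₁; inj₂) renaming (map to ⊎-map)
open import Data.Unit using (tt)
open import Data.Vec using (Vec; []; _∷_; tabulate; lookup; map; zipWith)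
open import Data.Vec.Properties
  using (lookup∘tabulate; tabulate∘lookup; tabulate-cong; lookup-zipWith; lookup-replicate;
         lookup-map; []=⇒lookup; lookup⇒[]=)
open import Function using (_∘_; mk⇔)
open import Relation.Nullary using (does; yes; no)
open import Relation.Nullary.Decidable using (dec-true; dec-false)
open import Relation.Binary.PropositionalEquality

variable
  n k m : ℕ

contradictionᵇ : ∀ {b} {A : Set} → b ≡ true → b ≡ false → A
contradictionᵇ refl ()

∧-true⁺ : ∀ {a b} → a ≡ true → b ≡ true → a ∧ b ≡ true
∧-true⁺ refl refl = refl

∧-true⁻ : ∀ {a b} → a ∧ b ≡ true → a ≡ true × b ≡ true
∧-true⁻ {true} {true} refl = refl , refl

∨-true⁻ : ∀ {a b} → a ∨ b ≡ true → a ≡ true ⊎ b ≡ true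
∨-true⁻ {true}  _ = inj₁ refl
∨-true⁻ {false} h = inj₂ h

not∨-true⁺ : ∀ {a b} → (a ≡ true → b ≡ true) → not a ∨ b ≡ true
not∨-true⁺ {true}  h = h refl
not∨-true⁺ {false} h = refl

not∨-true⁻ : ∀ {a b} → not a ∨ b ≡ true → a ≡ true → b ≡ true
not∨-true⁻ h refl = h

≡ᵇ-true⁺ : ∀ {a b} → a ≡ b → a ≡ᵇ b ≡ true
≡ᵇ-true⁺ {true}  refl = refl
≡ᵇ-true⁺ {false} refl = refl

≡ᵇ-true⁻ : ∀ {a b} → a ≡ᵇ b ≡ true → a ≡ b
≡ᵇ-true⁻ {true}  {true}  _ = refl
≡ᵇ-true⁻ {false} {false} _ = refl

allFinᵇ⁺ : {p : Fin n → Bool} → (∀ i → p i ≡ true) → allFinᵇ p ≡ true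
allFinᵇ⁺ {ℕ.zero}  h = refl
allFinᵇ⁺ {ℕ.suc n} h = ∧-true⁺ (h zero) (allFinᵇ⁺ (h ∘ suc))

allFinᵇ⁻ : {p : Fin n → Bool} → allFinᵇ p ≡ true → ∀ i → p i ≡ true
allFinᵇ⁻ {ℕ.suc n} h zero    = proj₁ (∧-true⁻ h)
allFinᵇ⁻ {ℕ.suc n} h (suc i) = allFinᵇ⁻ (proj₂ (∧-true⁻ h)) i

anySubsetᵇ⁺ : {p : Subset n → Bool} (S : Subset n) → p S ≡ true → anySubsetᵇ p ≡ true
anySubsetᵇ⁺ {ℕ.zero}          []          h = h
anySubsetᵇ⁺ {ℕ.suc n} {p = p} (true ∷ S)  h rewrite anySubsetᵇ⁺ {p = p ∘ (true ∷_)} S h = refl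
anySubsetᵇ⁺ {ℕ.suc n} {p = p} (false ∷ S) h rewrite anySubsetᵇ⁺ {p = p ∘ (false ∷_)} S h = ∨-zeroʳ _

anySubsetᵇ⁻ : {p : Subset n → Bool} → anySubsetᵇ p ≡ true → ∃ λ S → p S ≡ true
anySubsetᵇ⁻ {ℕ.zero}      h = [] , h
anySubsetᵇ⁻ {ℕ.suc n} {p} h with anySubsetᵇ (p ∘ (true ∷_)) in e
... | true  = let S , pS = anySubsetᵇ⁻ e in true ∷ S , pS
... | false = let S , pS = anySubsetᵇ⁻ h in false ∷ S , pS

lookup-ext : {S S′ : Subset n} → (∀ i → lookup S i ≡ lookup S′ i) → S ≡ S′
lookup-ext {S = S} {S′} h = trans (sym (tabulate∘lookup S)) (trans (tabulate-cong h) (tabulate∘lookup S′))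

≟ˢ⁺ : {S S′ : Subset n} → S ≡ S′ → S ≟ˢ S′ ≡ true
≟ˢ⁺ {S = S} refl = allFinᵇ⁺ λ i → ≡ᵇ-true⁺ {lookup S i} refl

≟ˢ⁻ : {S S′ : Subset n} → S ≟ˢ S′ ≡ true → S ≡ S′
≟ˢ⁻ h = lookup-ext λ i → ≡ᵇ-true⁻ (allFinᵇ⁻ h i)

⊆ᵇ⁺ : {S S′ : Subset n} → S ⊆ S′ → S ⊆ᵇ S′ ≡ true
⊆ᵇ⁺ S⊆S′ = allFinᵇ⁺ λ i → not∨-true⁺ λ Si → []=⇒lookup (S⊆S′ (lookup⇒[]= i _ Si))

⊆ᵇ⁻ : {S S′ : Subset n} → S ⊆ᵇ S′ ≡ true → S ⊆ S′
⊆ᵇ⁻ h {i} i∈S = lookup⇒[]= i _ (not∨-true⁻ (allFinᵇ⁻ h i) ([]=⇒lookup i∈S))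

⊆⇒∩≡ : {S R : Subset n} → S ⊆ R → S ∩ R ≡ S
⊆⇒∩≡ S⊆R = ⊆-antisym (proj₁ ∘ x∈p∩q⁻ _ _) (λ x∈S → x∈p∩q⁺ (x∈S , S⊆R x∈S))

∪-mono : {S S′ R R′ : Subset n} → S ⊆ S′ → R ⊆ R′ → S ∪ R ⊆ S′ ∪ R′
∪-mono S⊆S′ R⊆R′ x∈S∪R with x∈p∪q⁻ _ _ x∈S∪R
... | inj₁ x∈S = x∈p∪q⁺ (inj₁ (S⊆S′ x∈S))
... | inj₂ x∈R = x∈p∪q⁺ (inj₂ (R⊆R′ x∈R))

∪-least : {S R U : Subset n} → S ⊆ U → R ⊆ U → S ∪ R ⊆ U
∪-least S⊆U R⊆U = ⊆-trans (∪-mono S⊆U R⊆U) (⊆-reflexive (∪-idem _))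

∩-mono : {S S′ R R′ : Subset n} → S ⊆ S′ → R ⊆ R′ → S ∩ R ⊆ S′ ∩ R′
∩-mono S⊆S′ R⊆R′ x∈S∩R = let x∈S , x∈R = x∈p∩q⁻ _ _ x∈S∩R in x∈p∩q⁺ (S⊆S′ x∈S , R⊆R′ x∈R)

∈-disjoint : ∀ {S R : Subset n} {x} → Disj S R → x ∈ S → x ∈ R → Empty
∈-disjoint S∩R≡⊥ x∈S x∈R = ∉⊥ (subst (_ ∈_) S∩R≡⊥ (x∈p∩q⁺ (x∈S , x∈R)))

-- ∪ and ∩ act pointwise, so an identity between ∪/∩-expressions in subsets, under equational
-- hypotheses, holds as soon as no assignment of truth values to the variables refutes it.
module SubsetSolver where

  infixr 7 _∩ₑ_
  infixr 6 _∪ₑ_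

  data Expr (k : ℕ) : Set where
    var        : Fin k → Expr k
    _∪ₑ_ _∩ₑ_ : Expr k → Expr k → Expr k
    ∅ₑ         : Expr k

  x₀ : Expr (ℕ.suc k)
  x₀ = var zero
  x₁ : Expr (ℕ.suc (ℕ.suc k))
  x₁ = var (suc zero)
  x₂ : Expr (ℕ.suc (ℕ.suc (ℕ.suc k)))
  x₂ = var (suc (suc zero))
  x₃ : Expr (ℕ.suc (ℕ.suc (ℕ.suc (ℕ.suc k))))
  x₃ = var (suc (suc (suc zero)))
  x₄ : Expr (ℕ.suc (ℕ.suc (ℕ.suc (ℕ.suc (ℕ.suc k)))))
  x₄ = var (suc (suc (suc (suc zero))))
  x₅ : Expr (ℕ.suc (ℕ.suc (ℕ.suc (ℕ.suc (ℕ.suc (ℕ.suc k))))))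
  x₅ = var (suc (suc (suc (suc (suc zero)))))

  ⟦_⟧ : Expr k → Vec (Subset n) k → Subset n
  ⟦ var i  ⟧ ρ = lookup ρ i
  ⟦ a ∪ₑ b ⟧ ρ = ⟦ a ⟧ ρ ∪ ⟦ b ⟧ ρ
  ⟦ a ∩ₑ b ⟧ ρ = ⟦ a ⟧ ρ ∩ ⟦ b ⟧ ρ
  ⟦ ∅ₑ     ⟧ ρ = ⊥

  ⟦_⟧ᵇ : Expr k → Vec Bool k → Bool
  ⟦ var i  ⟧ᵇ v = lookup v i
  ⟦ a ∪ₑ b ⟧ᵇ v = ⟦ a ⟧ᵇ v ∨ ⟦ b ⟧ᵇ v
  ⟦ a ∩ₑ b ⟧ᵇ v = ⟦ a ⟧ᵇ v ∧ ⟦ b ⟧ᵇ v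
  ⟦ ∅ₑ     ⟧ᵇ v = false

  Equation : ℕ → Set
  Equation k = Expr k × Expr k

  _⊨_ : Vec (Subset n) k → Equation k → Set
  ρ ⊨ (a , b) = ⟦ a ⟧ ρ ≡ ⟦ b ⟧ ρ

  _⊨ᵇ_ : Vec Bool k → Equation k → Bool
  v ⊨ᵇ (a , b) = ⟦ a ⟧ᵇ v ≡ᵇ ⟦ b ⟧ᵇ v

  _⊨ᵇ*_ : Vec Bool k → List (Equation k) → Bool
  v ⊨ᵇ* []       = true
  v ⊨ᵇ* (e ∷ es) = (v ⊨ᵇ e) ∧ (v ⊨ᵇ* es)

  counterexample : List (Equation k) → Equation k → Vec Bool k → Bool
  counterexample hs e v = (v ⊨ᵇ* hs) ∧ not (v ⊨ᵇ e)

  at : Fin n → Vec (Subset n) k → Vec Bool k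
  at i = map (λ S → lookup S i)

  lookup-⟦⟧ : (e : Expr k) (ρ : Vec (Subset n) k) (i : Fin n) → lookup (⟦ e ⟧ ρ) i ≡ ⟦ e ⟧ᵇ (at i ρ)
  lookup-⟦⟧ (var j)  ρ i = sym (lookup-map j _ ρ)
  lookup-⟦⟧ (a ∪ₑ b) ρ i =
    trans (lookup-zipWith _∨_ i (⟦ a ⟧ ρ) (⟦ b ⟧ ρ)) (cong₂ _∨_ (lookup-⟦⟧ a ρ i) (lookup-⟦⟧ b ρ i))
  lookup-⟦⟧ (a ∩ₑ b) ρ i =
    trans (lookup-zipWith _∧_ i (⟦ a ⟧ ρ) (⟦ b ⟧ ρ)) (cong₂ _∧_ (lookup-⟦⟧ a ρ i) (lookup-⟦⟧ b ρ i))
  lookup-⟦⟧ ∅ₑ       ρ i = lookup-replicate i false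

  ⊨-at : (ρ : Vec (Subset n) k) (e : Equation k) (i : Fin n) → ρ ⊨ e → at i ρ ⊨ᵇ e ≡ true
  ⊨-at ρ (a , b) i h = ≡ᵇ-true⁺ {⟦ a ⟧ᵇ (at i ρ)}
    (trans (sym (lookup-⟦⟧ a ρ i)) (trans (cong (λ S → lookup S i) h) (lookup-⟦⟧ b ρ i)))

  ⊨*-at : (ρ : Vec (Subset n) k) {hs : List (Equation k)} (i : Fin n) →
          All (ρ ⊨_) hs → at i ρ ⊨ᵇ* hs ≡ true
  ⊨*-at ρ         i []       = refl
  ⊨*-at ρ {e ∷ _} i (h ∷ hs) = ∧-true⁺ (⊨-at ρ e i h) (⊨*-at ρ i hs)

  solve : (hs : List (Equation k)) (e : Equation k) → anySubsetᵇ (counterexample hs e) ≡ false →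
          (ρ : Vec (Subset n) k) → All (ρ ⊨_) hs → ρ ⊨ e
  solve hs (a , b) no-counterexample ρ hyps = lookup-ext λ i →
    trans (lookup-⟦⟧ a ρ i) (trans (≡ᵇ-true⁻ (holds i)) (sym (lookup-⟦⟧ b ρ i)))
    where
    holds : ∀ i → at i ρ ⊨ᵇ (a , b) ≡ true
    holds i with at i ρ ⊨ᵇ (a , b) in fails
    ... | true  = refl
    ... | false = contradictionᵇ
      (anySubsetᵇ⁺ (at i ρ) (∧-true⁺ (⊨*-at ρ i hyps) (cong not fails))) no-counterexample

open SubsetSolver using (_∪ₑ_; _∩ₑ_; ∅ₑ; x₀; x₁; x₂; x₃; x₄; x₅; solve)

∩-∩-absorb : ∀ {A B O : Subset n} → A ⊆ B → (O ∩ B) ∩ A ≡ O ∩ A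
∩-∩-absorb {A = A} {B} {O} A⊆B =
  solve ((x₀ ∩ₑ x₁ , x₀) ∷ []) ((x₂ ∩ₑ x₁) ∩ₑ x₀ , x₂ ∩ₑ x₀) refl (A ∷ B ∷ O ∷ []) (⊆⇒∩≡ A⊆B ∷ [])

reindex : (Fin n → Fin n) → Subset n → Subset n
reindex f S = tabulate (λ i → lookup S (f i))

preimage : Permutation′ n → Subset n → Subset n
preimage π = reindex (π ⟨$⟩ʳ_)

lookup-reindex : ∀ (f : Fin n → Fin n) S i → lookup (reindex f S) i ≡ lookup S (f i)
lookup-reindex f S = lookup∘tabulate (λ i → lookup S (f i))

∈-reindex⁺ : ∀ {f : Fin n → Fin n} {S i} → f i ∈ S → i ∈ reindex f S
∈-reindex⁺ {f = f} {S} {i} fi∈S = lookup⇒[]= i _ (trans (lookup-reindex f S i) ([]=⇒lookup fi∈S))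

∈-reindex⁻ : ∀ {f : Fin n → Fin n} {S i} → i ∈ reindex f S → f i ∈ S
∈-reindex⁻ {f = f} {S} {i} i∈fS =
  lookup⇒[]= (f i) S (trans (sym (lookup-reindex f S i)) ([]=⇒lookup i∈fS))

reindex-mono : ∀ {f : Fin n → Fin n} {S R} → S ⊆ R → reindex f S ⊆ reindex f R
reindex-mono S⊆R = ∈-reindex⁺ ∘ S⊆R ∘ ∈-reindex⁻

reindex-zipWith : ∀ (g : Bool → Bool → Bool) (f : Fin n → Fin n) S R →
                  reindex f (zipWith g S R) ≡ zipWith g (reindex f S) (reindex f R)
reindex-zipWith g f S R = lookup-ext λ i → begin
  lookup (reindex f (zipWith g S R)) i                ≡⟨ lookup-reindex f (zipWith g S R) i ⟩
  lookup (zipWith g S R) (f i)                        ≡⟨ lookup-zipWith g (f i) S R ⟩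
  g (lookup S (f i)) (lookup R (f i))                 ≡⟨ cong₂ g (lookup-reindex f S i) (lookup-reindex f R i) ⟨
  g (lookup (reindex f S) i) (lookup (reindex f R) i) ≡⟨ lookup-zipWith g i (reindex f S) (reindex f R) ⟨
  lookup (zipWith g (reindex f S) (reindex f R)) i    ∎
  where open ≡-Reasoning

reindex-∪ : ∀ (f : Fin n → Fin n) S R → reindex f (S ∪ R) ≡ reindex f S ∪ reindex f R
reindex-∪ = reindex-zipWith _∨_

reindex-∩ : ∀ (f : Fin n → Fin n) S R → reindex f (S ∩ R) ≡ reindex f S ∩ reindex f R
reindex-∩ = reindex-zipWith _∧_

reindex-⊥ : ∀ (f : Fin n → Fin n) → reindex f ⊥ ≡ ⊥
reindex-⊥ f = lookup-ext λ i →
  trans (lookup-reindex f ⊥ i) (trans (lookup-replicate (f i) false) (sym (lookup-replicate i false)))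

reindex-reindex : ∀ (f g : Fin n → Fin n) S → reindex f (reindex g S) ≡ reindex (g ∘ f) S
reindex-reindex f g S = lookup-ext λ i → trans (lookup-reindex f (reindex g S) i)
  (trans (lookup-reindex g S (f i)) (sym (lookup-reindex (g ∘ f) S i)))

reindex-id : ∀ {f : Fin n → Fin n} → (∀ i → f i ≡ i) → ∀ S → reindex f S ≡ S
reindex-id {f = f} f≗id S = lookup-ext λ i → trans (lookup-reindex f S i) (cong (lookup S) (f≗id i))

preimage-image : ∀ (π : Permutation′ n) S → preimage π (image π S) ≡ S
preimage-image π S = trans (reindex-reindex _ _ S) (reindex-id (λ i → inverseˡ π) S)

image-preimage : ∀ (π : Permutation′ n) S → image π (preimage π S) ≡ S
image-preimage π S = trans (reindex-reindex _ _ S) (reindex-id (λ i → inverseʳ π) S)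

-- A record rather than the bare equation opens T O ≡ true, so that T and O can be recovered by
-- unification from the type of a proof.
record Open (T : RawTopo n) (O : Subset n) : Set where
  constructor mkOpen
  field open≡true : opens T O ≡ true
open Open

module Topology {T : RawTopo n} (t : IsTopology T) where

  open-⊆ : ∀ {O} → Open T O → O ⊆ pts T
  open-⊆ (mkOpen o) = proj₁ t _ o

  ∅-open : Open T ⊥
  ∅-open = mkOpen (proj₁ (proj₂ t))

  pts-open : Open T (pts T)
  pts-open = mkOpen (proj₁ (proj₂ (proj₂ t)))

  ∪-open : ∀ {O O′} → Open T O → Open T O′ → Open T (O ∪ O′)
  ∪-open (mkOpen o) (mkOpen o′) = mkOpen (proj₁ (proj₂ (proj₂ (proj₂ t))) _ _ o o′)

  ∩-open : ∀ {O O′} → Open T O → Open T O′ → Open T (O ∩ O′)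
  ∩-open (mkOpen o) (mkOpen o′) = mkOpen (proj₂ (proj₂ (proj₂ (proj₂ t))) _ _ o o′)

  open-∩pts : ∀ {O} → Open T O → O ∩ pts T ≡ O
  open-∩pts = ⊆⇒∩≡ ∘ open-⊆

isTopology : {T : RawTopo n} → (∀ {O} → Open T O → O ⊆ pts T) → Open T ⊥ → Open T (pts T) →
             (∀ {O O′} → Open T O → Open T O′ → Open T (O ∪ O′)) →
             (∀ {O O′} → Open T O → Open T O′ → Open T (O ∩ O′)) → IsTopology T
isTopology ⊆pts ∅-open pts-open ∪-open ∩-open =
  (λ _ → ⊆pts ∘ mkOpen) , open≡true ∅-open , open≡true pts-open ,
  (λ _ _ o o′ → open≡true (∪-open (mkOpen o) (mkOpen o′))) ,
  (λ _ _ o o′ → open≡true (∩-open (mkOpen o) (mkOpen o′)))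

≈ᵀ-intro : {T T′ : RawTopo n} → pts T ≡ pts T′ →
           (∀ {O} → Open T O → Open T′ O) → (∀ {O} → Open T′ O → Open T O) → T ≈ᵀ T′
≈ᵀ-intro pts≡ to from = pts≡ , λ O → ⇔→≡ (mk⇔ (open≡true ∘ to ∘ mkOpen) (open≡true ∘ from ∘ mkOpen))

≈ᵀ-sym : {T T′ : RawTopo n} → T ≈ᵀ T′ → T′ ≈ᵀ T
≈ᵀ-sym (pts≡ , opens≡) = sym pts≡ , sym ∘ opens≡

≈ᵀ-trans : {T T′ T″ : RawTopo n} → T ≈ᵀ T′ → T′ ≈ᵀ T″ → T ≈ᵀ T″
≈ᵀ-trans (pts≡ , opens≡) (pts≡′ , opens≡′) = trans pts≡ pts≡′ , λ O → trans (opens≡ O) (opens≡′ O)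

oneᵀ-open⁺ : ∀ {S : Subset n} → S ≡ ⊥ → Open oneᵀ S
oneᵀ-open⁺ = mkOpen ∘ ≟ˢ⁺

oneᵀ-open⁻ : ∀ {S : Subset n} → Open oneᵀ S → S ≡ ⊥
oneᵀ-open⁻ = ≟ˢ⁻ ∘ open≡true

restrictᵀ-open⁺ : ∀ {Z} {T : RawTopo n} {O} → Open T O → Open (restrictᵀ Z T) (O ∩ Z)
restrictᵀ-open⁺ {Z = Z} {O = O} (mkOpen o) = mkOpen (anySubsetᵇ⁺ O (∧-true⁺ o (≟ˢ⁺ {S = O ∩ Z} refl)))

restrictᵀ-open⁻ : ∀ {Z} {T : RawTopo n} {S} → Open (restrictᵀ Z T) S → ∃ λ O → Open T O × S ≡ O ∩ Z
restrictᵀ-open⁻ (mkOpen h) = let O , h = anySubsetᵇ⁻ h ; o , S≡ = ∧-true⁻ h in O , mkOpen o , ≟ˢ⁻ S≡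

mulᵀ-open⁺ : ∀ {T T′ : RawTopo n} {I J} → Open T I → Open T′ J → Open (mulᵀ T T′) (I ∪ J)
mulᵀ-open⁺ {I = I} {J} (mkOpen i) (mkOpen j) =
  mkOpen (anySubsetᵇ⁺ I (anySubsetᵇ⁺ J (∧-true⁺ i (∧-true⁺ j (≟ˢ⁺ {S = I ∪ J} refl)))))

mulᵀ-open⁻ : ∀ (T T′ : RawTopo n) {S} → Open (mulᵀ T T′) S → ∃₂ λ I J → Open T I × Open T′ J × S ≡ I ∪ J
mulᵀ-open⁻ T T′ (mkOpen h) =
  let I , h = anySubsetᵇ⁻ h ; J , h = anySubsetᵇ⁻ h ; i , h = ∧-true⁻ h ; j , S≡ = ∧-true⁻ h
  in I , J , mkOpen i , mkOpen j , ≟ˢ⁻ S≡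

relabelᵀ-open⁺ : ∀ (π : Permutation′ n) {T S} → Open T (preimage π S) → Open (relabelᵀ π T) S
relabelᵀ-open⁺ π (mkOpen o) = mkOpen o

relabelᵀ-open⁻ : ∀ (π : Permutation′ n) T {S} → Open (relabelᵀ π T) S → Open T (preimage π S)
relabelᵀ-open⁻ π T (mkOpen o) = mkOpen o

image-open : ∀ (π : Permutation′ n) {T O} → Open T O → Open (relabelᵀ π T) (image π O)
image-open π {T} {O} = relabelᵀ-open⁺ π ∘ subst (Open T) (sym (preimage-image π O))

open-in-open-subspace : ∀ {T : RawTopo n} {W S} → IsTopology T → Open T W → Open (restrictᵀ W T) S →
                        Open T S
open-in-open-subspace t w h with restrictᵀ-open⁻ h
... | O , o , refl = Topology.∩-open t o w

-- S = O ∩ W for an open O ⊆ W ∪ Z, and then S ∪ Z = O ∪ Z.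
glue-open : ∀ {T : RawTopo n} {W Z S} → IsTopology T → Open T Z → pts T ⊆ W ∪ Z →
            Open (restrictᵀ W T) S → Open T (S ∪ Z)
glue-open {T = T} {W} {Z} t z cover h with restrictᵀ-open⁻ h
... | O , o , refl =
  subst (Open T) (solve ((x₀ ∩ₑ (x₁ ∪ₑ x₂) , x₀) ∷ []) (x₀ ∪ₑ x₂ , (x₀ ∩ₑ x₁) ∪ₑ x₂) refl
                        (O ∷ W ∷ Z ∷ []) (⊆⇒∩≡ (⊆-trans (Topology.open-⊆ t o) cover) ∷ []))
        (Topology.∪-open t o z)

-- The bialgebra Topo

oneᵀ-isTopology : IsTopology (oneᵀ {n})
oneᵀ-isTopology = isTopology (⊆-reflexive ∘ oneᵀ-open⁻) (oneᵀ-open⁺ refl) (oneᵀ-open⁺ refl) ∪-closed ∩-closed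
  where
  ∪-closed : ∀ {O O′} → Open oneᵀ O → Open oneᵀ O′ → Open oneᵀ (O ∪ O′)
  ∪-closed o o′ = oneᵀ-open⁺ (trans (cong₂ _∪_ (oneᵀ-open⁻ o) (oneᵀ-open⁻ o′)) (∪-idem ⊥))
  ∩-closed : ∀ {O O′} → Open oneᵀ O → Open oneᵀ O′ → Open oneᵀ (O ∩ O′)
  ∩-closed o o′ = oneᵀ-open⁺ (trans (cong₂ _∩_ (oneᵀ-open⁻ o) (oneᵀ-open⁻ o′)) (∩-idem ⊥))

mulᵀ-isTopology : ∀ {a b : RawTopo n} → IsTopology a → IsTopology b → Disj (pts a) (pts b) →
                  IsTopology (mulᵀ a b)
mulᵀ-isTopology {a = a} {b} ta tb disjoint =
  isTopology ⊆pts (subst (Open (mulᵀ a b)) (∪-idem ⊥) (mulᵀ-open⁺ A.∅-open B.∅-open))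
             (mulᵀ-open⁺ A.pts-open B.pts-open) ∪-closed ∩-closed
  where
  module A = Topology ta
  module B = Topology tb
  ⊆pts : ∀ {S} → Open (mulᵀ a b) S → S ⊆ pts a ∪ pts b
  ⊆pts h with mulᵀ-open⁻ a b h
  ... | I , J , i , j , refl = ∪-mono (A.open-⊆ i) (B.open-⊆ j)
  ∪-closed : ∀ {O O′} → Open (mulᵀ a b) O → Open (mulᵀ a b) O′ → Open (mulᵀ a b) (O ∪ O′)
  ∪-closed h h′ with mulᵀ-open⁻ a b h | mulᵀ-open⁻ a b h′
  ... | I , J , i , j , refl | I′ , J′ , i′ , j′ , refl =
    subst (Open (mulᵀ a b))
          (solve [] ((x₀ ∪ₑ x₂) ∪ₑ (x₁ ∪ₑ x₃) , (x₀ ∪ₑ x₁) ∪ₑ (x₂ ∪ₑ x₃)) refl (I ∷ J ∷ I′ ∷ J′ ∷ []) [])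
          (mulᵀ-open⁺ (A.∪-open i i′) (B.∪-open j j′))
  -- The cross terms I ∩ J′ and J ∩ I′ vanish because pts a and pts b are disjoint.
  ∩-closed : ∀ {O O′} → Open (mulᵀ a b) O → Open (mulᵀ a b) O′ → Open (mulᵀ a b) (O ∩ O′)
  ∩-closed h h′ with mulᵀ-open⁻ a b h | mulᵀ-open⁻ a b h′
  ... | I , J , i , j , refl | I′ , J′ , i′ , j′ , refl =
    subst (Open (mulᵀ a b))
          (solve ((x₀ ∩ₑ x₄ , x₀) ∷ (x₁ ∩ₑ x₅ , x₁) ∷ (x₂ ∩ₑ x₄ , x₂) ∷ (x₃ ∩ₑ x₅ , x₃) ∷ (x₄ ∩ₑ x₅ , ∅ₑ) ∷ [])
                 ((x₀ ∩ₑ x₂) ∪ₑ (x₁ ∩ₑ x₃) , (x₀ ∪ₑ x₁) ∩ₑ (x₂ ∪ₑ x₃)) refl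
                 (I ∷ J ∷ I′ ∷ J′ ∷ pts a ∷ pts b ∷ [])
                 (A.open-∩pts i ∷ B.open-∩pts j ∷ A.open-∩pts i′ ∷ B.open-∩pts j′ ∷ disjoint ∷ []))
          (mulᵀ-open⁺ (A.∩-open i i′) (B.∩-open j j′))

restrictᵀ-isTopology : ∀ Z {T : RawTopo n} → IsTopology T → IsTopology (restrictᵀ Z T)
restrictᵀ-isTopology Z {T} t =
  isTopology ⊆pts (subst (Open (restrictᵀ Z T)) (∩-zeroˡ Z) (restrictᵀ-open⁺ ∅-open))
             (restrictᵀ-open⁺ pts-open) ∪-closed ∩-closed
  where
  open Topology t
  ⊆pts : ∀ {S} → Open (restrictᵀ Z T) S → S ⊆ pts T ∩ Z
  ⊆pts h with restrictᵀ-open⁻ h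
  ... | O , o , refl = ∩-mono (open-⊆ o) ⊆-refl
  ∪-closed : ∀ {S S′} → Open (restrictᵀ Z T) S → Open (restrictᵀ Z T) S′ → Open (restrictᵀ Z T) (S ∪ S′)
  ∪-closed h h′ with restrictᵀ-open⁻ h | restrictᵀ-open⁻ h′
  ... | O , o , refl | O′ , o′ , refl =
    subst (Open (restrictᵀ Z T)) (∩-distribʳ-∪ Z O O′) (restrictᵀ-open⁺ (∪-open o o′))
  ∩-closed : ∀ {S S′} → Open (restrictᵀ Z T) S → Open (restrictᵀ Z T) S′ → Open (restrictᵀ Z T) (S ∩ S′)
  ∩-closed h h′ with restrictᵀ-open⁻ h | restrictᵀ-open⁻ h′
  ... | O , o , refl | O′ , o′ , refl =
    subst (Open (restrictᵀ Z T)) (solve [] ((x₀ ∩ₑ x₁) ∩ₑ x₂ , (x₀ ∩ₑ x₂) ∩ₑ (x₁ ∩ₑ x₂)) refl (O ∷ O′ ∷ Z ∷ []) [])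
          (restrictᵀ-open⁺ (∩-open o o′))

copᵀ-isTopology : ∀ (a : RawTopo n) X Y → IsTopology a → Disj X Y → X ∪ Y ≡ pts a →
                  ∀ b c → copᵀ X Y a ≡ just (b , c) → IsTopology b × IsTopology c × pts b ≡ X × pts c ≡ Y
copᵀ-isTopology a X Y t _ cover b c eq with opens a Y | eq
... | true | refl = restrictᵀ-isTopology X t , restrictᵀ-isTopology Y t ,
                    trans (∩-comm _ X) (⊆⇒∩≡ (⊆pts (p⊆p∪q Y))) , trans (∩-comm _ Y) (⊆⇒∩≡ (⊆pts (q⊆p∪q X Y)))
  where
  ⊆pts : ∀ {W} → W ⊆ X ∪ Y → W ⊆ pts a
  ⊆pts = subst (_ ⊆_) cover

relabelᵀ-isTopology : ∀ (π : Permutation′ n) {T} → IsTopology T → IsTopology (relabelᵀ π T)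
relabelᵀ-isTopology π {T} t =
  isTopology ⊆pts (relabelᵀ-open⁺ π (subst (Open T) (sym (reindex-⊥ (π ⟨$⟩ʳ_))) ∅-open))
             (image-open π pts-open) ∪-closed ∩-closed
  where
  open Topology t
  ⊆pts : ∀ {S} → Open (relabelᵀ π T) S → S ⊆ image π (pts T)
  ⊆pts {S} o = subst (_⊆ image π (pts T)) (image-preimage π S)
                     (reindex-mono (open-⊆ (relabelᵀ-open⁻ π T o)))
  ∪-closed : ∀ {O O′} → Open (relabelᵀ π T) O → Open (relabelᵀ π T) O′ → Open (relabelᵀ π T) (O ∪ O′)
  ∪-closed {O} {O′} o o′ =
    relabelᵀ-open⁺ π (subst (Open T) (sym (reindex-∪ (π ⟨$⟩ʳ_) O O′))
                            (∪-open (relabelᵀ-open⁻ π T o) (relabelᵀ-open⁻ π T o′)))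
  ∩-closed : ∀ {O O′} → Open (relabelᵀ π T) O → Open (relabelᵀ π T) O′ → Open (relabelᵀ π T) (O ∩ O′)
  ∩-closed {O} {O′} o o′ =
    relabelᵀ-open⁺ π (subst (Open T) (sym (reindex-∩ (π ⟨$⟩ʳ_) O O′))
                            (∩-open (relabelᵀ-open⁻ π T o) (relabelᵀ-open⁻ π T o′)))

relabelᵀ-id : ∀ (T : RawTopo n) → relabelᵀ Perm.id T ≈ᵀ T
relabelᵀ-id T = reindex-id (λ _ → refl) (pts T) , λ O → cong (opens T) (reindex-id (λ _ → refl) O)

relabelᵀ-∘ : ∀ (π σ : Permutation′ n) T → relabelᵀ (π ∘ₚ σ) T ≈ᵀ relabelᵀ σ (relabelᵀ π T)
relabelᵀ-∘ π σ T = sym (reindex-reindex (σ ⟨$⟩ˡ_) (π ⟨$⟩ˡ_) (pts T)) ,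
                   λ O → cong (opens T) (sym (reindex-reindex (π ⟨$⟩ʳ_) (σ ⟨$⟩ʳ_) O))

relabelᵀ-oneᵀ : ∀ (π : Permutation′ n) → relabelᵀ π oneᵀ ≈ᵀ oneᵀ
relabelᵀ-oneᵀ π = ≈ᵀ-intro (reindex-⊥ (π ⟨$⟩ˡ_)) to from
  where
  to : ∀ {S} → Open (relabelᵀ π oneᵀ) S → Open oneᵀ S
  to {S} o = oneᵀ-open⁺ (begin
    S                      ≡⟨ image-preimage π S ⟨
    image π (preimage π S) ≡⟨ cong (image π) (oneᵀ-open⁻ (relabelᵀ-open⁻ π oneᵀ o)) ⟩
    image π ⊥              ≡⟨ reindex-⊥ (π ⟨$⟩ˡ_) ⟩
    ⊥                      ∎)
    where open ≡-Reasoning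
  from : ∀ {S} → Open oneᵀ S → Open (relabelᵀ π oneᵀ) S
  from o = relabelᵀ-open⁺ π (oneᵀ-open⁺ (trans (cong (preimage π) (oneᵀ-open⁻ o)) (reindex-⊥ (π ⟨$⟩ʳ_))))

relabelᵀ-mulᵀ : ∀ (π : Permutation′ n) a b → relabelᵀ π (mulᵀ a b) ≈ᵀ mulᵀ (relabelᵀ π a) (relabelᵀ π b)
relabelᵀ-mulᵀ π a b = ≈ᵀ-intro (reindex-∪ (π ⟨$⟩ˡ_) (pts a) (pts b)) to from
  where
  to : ∀ {S} → Open (relabelᵀ π (mulᵀ a b)) S → Open (mulᵀ (relabelᵀ π a) (relabelᵀ π b)) S
  to {S} h with mulᵀ-open⁻ a b (relabelᵀ-open⁻ π (mulᵀ a b) h)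
  ... | I , J , i , j , S≡ = subst (Open (mulᵀ (relabelᵀ π a) (relabelᵀ π b))) (begin
    image π I ∪ image π J  ≡⟨ reindex-∪ (π ⟨$⟩ˡ_) I J ⟨
    image π (I ∪ J)        ≡⟨ cong (image π) S≡ ⟨
    image π (preimage π S) ≡⟨ image-preimage π S ⟩
    S                      ∎) (mulᵀ-open⁺ (image-open π {a} i) (image-open π {b} j))
    where open ≡-Reasoning
  from : ∀ {S} → Open (mulᵀ (relabelᵀ π a) (relabelᵀ π b)) S → Open (relabelᵀ π (mulᵀ a b)) S
  from h with mulᵀ-open⁻ (relabelᵀ π a) (relabelᵀ π b) h
  ... | I , J , i , j , refl =
    relabelᵀ-open⁺ π (subst (Open (mulᵀ a b)) (sym (reindex-∪ (π ⟨$⟩ʳ_) I J))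
                            (mulᵀ-open⁺ (relabelᵀ-open⁻ π a i) (relabelᵀ-open⁻ π b j)))

restrictᵀ-relabelᵀ : ∀ (π : Permutation′ n) X a →
                     restrictᵀ (image π X) (relabelᵀ π a) ≈ᵀ relabelᵀ π (restrictᵀ X a)
restrictᵀ-relabelᵀ π X a = ≈ᵀ-intro (sym (reindex-∩ (π ⟨$⟩ˡ_) (pts a) X)) to from
  where
  to : ∀ {S} → Open (restrictᵀ (image π X) (relabelᵀ π a)) S → Open (relabelᵀ π (restrictᵀ X a)) S
  to h with restrictᵀ-open⁻ h
  ... | O , o , refl = relabelᵀ-open⁺ π (subst (Open (restrictᵀ X a)) (begin
    preimage π O ∩ X                      ≡⟨ cong (preimage π O ∩_) (preimage-image π X) ⟨
    preimage π O ∩ preimage π (image π X) ≡⟨ reindex-∩ (π ⟨$⟩ʳ_) O (image π X) ⟨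
    preimage π (O ∩ image π X)            ∎) (restrictᵀ-open⁺ (relabelᵀ-open⁻ π a o)))
    where open ≡-Reasoning
  from : ∀ {S} → Open (relabelᵀ π (restrictᵀ X a)) S → Open (restrictᵀ (image π X) (relabelᵀ π a)) S
  from {S} h with restrictᵀ-open⁻ (relabelᵀ-open⁻ π (restrictᵀ X a) h)
  ... | O , o , S≡ = subst (Open (restrictᵀ (image π X) (relabelᵀ π a))) (begin
    image π O ∩ image π X  ≡⟨ reindex-∩ (π ⟨$⟩ˡ_) O X ⟨
    image π (O ∩ X)        ≡⟨ cong (image π) S≡ ⟨
    image π (preimage π S) ≡⟨ image-preimage π S ⟩
    S                      ∎) (restrictᵀ-open⁺ (image-open π o))
    where open ≡-Reasoning

copᵀ-relabelᵀ : ∀ (π : Permutation′ n) a X Y →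
                Lift₂ _≈ᵀ_ (copᵀ (image π X) (image π Y) (relabelᵀ π a))
                           (mapᴹ (λ { (b , c) → (relabelᵀ π b , relabelᵀ π c) }) (copᵀ X Y a))
copᵀ-relabelᵀ π a X Y with opens a (preimage π (image π Y)) | opens a Y | cong (opens a) (preimage-image π Y)
... | true  | true  | _  = restrictᵀ-relabelᵀ π X a , restrictᵀ-relabelᵀ π Y a
... | false | false | _  = tt
... | true  | false | ()
... | false | true  | ()

mulᵀ-assoc : ∀ (a b c : RawTopo n) → mulᵀ (mulᵀ a b) c ≈ᵀ mulᵀ a (mulᵀ b c)
mulᵀ-assoc a b c = ≈ᵀ-intro (∪-assoc (pts a) (pts b) (pts c)) to from
  where
  to : ∀ {S} → Open (mulᵀ (mulᵀ a b) c) S → Open (mulᵀ a (mulᵀ b c)) S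
  to h with mulᵀ-open⁻ (mulᵀ a b) c h
  ... | K , L , k , l , refl with mulᵀ-open⁻ a b k
  ... | I , J , i , j , refl =
    subst (Open (mulᵀ a (mulᵀ b c))) (sym (∪-assoc I J L)) (mulᵀ-open⁺ i (mulᵀ-open⁺ j l))
  from : ∀ {S} → Open (mulᵀ a (mulᵀ b c)) S → Open (mulᵀ (mulᵀ a b) c) S
  from h with mulᵀ-open⁻ a (mulᵀ b c) h
  ... | I , K , i , k , refl with mulᵀ-open⁻ b c k
  ... | J , L , j , l , refl =
    subst (Open (mulᵀ (mulᵀ a b) c)) (∪-assoc I J L) (mulᵀ-open⁺ (mulᵀ-open⁺ i j) l)

mulᵀ-identityˡ : ∀ (a : RawTopo n) → mulᵀ oneᵀ a ≈ᵀ a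
mulᵀ-identityˡ a = ≈ᵀ-intro (∪-identityˡ (pts a)) to from
  where
  to : ∀ {S} → Open (mulᵀ oneᵀ a) S → Open a S
  to h with mulᵀ-open⁻ oneᵀ a h
  ... | I , J , i , j , refl = subst (Open a) (sym (trans (cong (_∪ J) (oneᵀ-open⁻ i)) (∪-identityˡ J))) j
  from : ∀ {S} → Open a S → Open (mulᵀ oneᵀ a) S
  from {S} o = subst (Open (mulᵀ oneᵀ a)) (∪-identityˡ S) (mulᵀ-open⁺ (oneᵀ-open⁺ refl) o)

mulᵀ-identityʳ : ∀ (a : RawTopo n) → mulᵀ a oneᵀ ≈ᵀ a
mulᵀ-identityʳ a = ≈ᵀ-intro (∪-identityʳ (pts a)) to from
  where
  to : ∀ {S} → Open (mulᵀ a oneᵀ) S → Open a S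
  to h with mulᵀ-open⁻ a oneᵀ h
  ... | I , J , i , j , refl = subst (Open a) (sym (trans (cong (I ∪_) (oneᵀ-open⁻ j)) (∪-identityʳ I))) i
  from : ∀ {S} → Open a S → Open (mulᵀ a oneᵀ) S
  from {S} o = subst (Open (mulᵀ a oneᵀ)) (∪-identityʳ S) (mulᵀ-open⁺ o (oneᵀ-open⁺ refl))

restrictᵀ-⊥ : ∀ {T : RawTopo n} → IsTopology T → restrictᵀ ⊥ T ≈ᵀ oneᵀ
restrictᵀ-⊥ {T = T} t = ≈ᵀ-intro (∩-zeroʳ (pts T)) to from
  where
  to : ∀ {S} → Open (restrictᵀ ⊥ T) S → Open oneᵀ S
  to h with restrictᵀ-open⁻ h
  ... | O , _ , refl = oneᵀ-open⁺ (∩-zeroʳ O)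
  from : ∀ {S} → Open oneᵀ S → Open (restrictᵀ ⊥ T) S
  from o rewrite oneᵀ-open⁻ o =
    subst (Open (restrictᵀ ⊥ T)) (∩-zeroʳ ⊥) (restrictᵀ-open⁺ (Topology.∅-open t))

restrictᵀ-pts : ∀ {T : RawTopo n} → IsTopology T → restrictᵀ (pts T) T ≈ᵀ T
restrictᵀ-pts {T = T} t = ≈ᵀ-intro (∩-idem (pts T)) to from
  where
  open Topology t
  to : ∀ {S} → Open (restrictᵀ (pts T) T) S → Open T S
  to h with restrictᵀ-open⁻ h
  ... | O , o , refl = subst (Open T) (sym (open-∩pts o)) o
  from : ∀ {S} → Open T S → Open (restrictᵀ (pts T) T) S
  from o = subst (Open (restrictᵀ (pts T) T)) (open-∩pts o) (restrictᵀ-open⁺ o)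

restrictᵀ-restrictᵀ : ∀ {A B : Subset n} (T : RawTopo n) → A ⊆ B →
                      restrictᵀ A (restrictᵀ B T) ≈ᵀ restrictᵀ A T
restrictᵀ-restrictᵀ {A = A} {B} T A⊆B = ≈ᵀ-intro (∩-∩-absorb A⊆B) to from
  where
  to : ∀ {S} → Open (restrictᵀ A (restrictᵀ B T)) S → Open (restrictᵀ A T) S
  to h with restrictᵀ-open⁻ h
  ... | _ , o′ , refl with restrictᵀ-open⁻ o′
  ... | O , o , refl = subst (Open (restrictᵀ A T)) (sym (∩-∩-absorb A⊆B)) (restrictᵀ-open⁺ o)
  from : ∀ {S} → Open (restrictᵀ A T) S → Open (restrictᵀ A (restrictᵀ B T)) S
  from h with restrictᵀ-open⁻ h
  ... | O , o , refl =
    subst (Open (restrictᵀ A (restrictᵀ B T))) (∩-∩-absorb A⊆B) (restrictᵀ-open⁺ (restrictᵀ-open⁺ o))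

restrictᵀ-mulᵀ : ∀ Z {a b : RawTopo n} → IsTopology a → IsTopology b →
                 restrictᵀ Z (mulᵀ a b) ≈ᵀ mulᵀ (restrictᵀ (Z ∩ pts a) a) (restrictᵀ (Z ∩ pts b) b)
restrictᵀ-mulᵀ Z {a} {b} ta tb = ≈ᵀ-intro (distribute ⊆-refl ⊆-refl) to from
  where
  distribute : ∀ {I J} → I ⊆ pts a → J ⊆ pts b → (I ∪ J) ∩ Z ≡ (I ∩ (Z ∩ pts a)) ∪ (J ∩ (Z ∩ pts b))
  distribute {I} {J} I⊆ J⊆ =
    solve ((x₀ ∩ₑ x₂ , x₀) ∷ (x₁ ∩ₑ x₃ , x₁) ∷ [])
          ((x₀ ∪ₑ x₁) ∩ₑ x₄ , (x₀ ∩ₑ (x₄ ∩ₑ x₂)) ∪ₑ (x₁ ∩ₑ (x₄ ∩ₑ x₃))) refl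
          (I ∷ J ∷ pts a ∷ pts b ∷ Z ∷ []) (⊆⇒∩≡ I⊆ ∷ ⊆⇒∩≡ J⊆ ∷ [])
  to : ∀ {S} → Open (restrictᵀ Z (mulᵀ a b)) S →
       Open (mulᵀ (restrictᵀ (Z ∩ pts a) a) (restrictᵀ (Z ∩ pts b) b)) S
  to h with restrictᵀ-open⁻ h
  ... | _ , o , refl with mulᵀ-open⁻ a b o
  ... | I , J , i , j , refl =
    subst (Open _) (sym (distribute (Topology.open-⊆ ta i) (Topology.open-⊆ tb j)))
          (mulᵀ-open⁺ (restrictᵀ-open⁺ i) (restrictᵀ-open⁺ j))
  from : ∀ {S} → Open (mulᵀ (restrictᵀ (Z ∩ pts a) a) (restrictᵀ (Z ∩ pts b) b)) S →
         Open (restrictᵀ Z (mulᵀ a b)) S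
  from h with mulᵀ-open⁻ (restrictᵀ (Z ∩ pts a) a) (restrictᵀ (Z ∩ pts b) b) h
  ... | _ , _ , i , j , refl with restrictᵀ-open⁻ i | restrictᵀ-open⁻ j
  ... | I , i , refl | J , j , refl =
    subst (Open (restrictᵀ Z (mulᵀ a b))) (distribute (Topology.open-⊆ ta i) (Topology.open-⊆ tb j))
          (restrictᵀ-open⁺ (mulᵀ-open⁺ i j))

mulᵀ-open-∩pts : ∀ {a b : RawTopo n} {Y} → IsTopology a → IsTopology b → Disj (pts a) (pts b) →
                 Open (mulᵀ a b) Y → Open a (Y ∩ pts a) × Open b (Y ∩ pts b)
mulᵀ-open-∩pts {a = a} {b} ta tb disjoint h with mulᵀ-open⁻ a b h
... | I , J , i , j , refl =
  subst (Open a) (sym (solve hypotheses ((x₀ ∪ₑ x₁) ∩ₑ x₂ , x₀) refl ρ facts)) i ,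
  subst (Open b) (sym (solve hypotheses ((x₀ ∪ₑ x₁) ∩ₑ x₃ , x₁) refl ρ facts)) j
  where
  ρ = I ∷ J ∷ pts a ∷ pts b ∷ []
  hypotheses = (x₀ ∩ₑ x₂ , x₀) ∷ (x₁ ∩ₑ x₃ , x₁) ∷ (x₂ ∩ₑ x₃ , ∅ₑ) ∷ []
  facts = Topology.open-∩pts ta i ∷ Topology.open-∩pts tb j ∷ disjoint ∷ []

mulᵀ-open-split : ∀ {a b : RawTopo n} {Y} → Y ⊆ pts a ∪ pts b →
                  Open a (Y ∩ pts a) → Open b (Y ∩ pts b) → Open (mulᵀ a b) Y
mulᵀ-open-split {a = a} {b} {Y} Y⊆ ya yb =
  subst (Open (mulᵀ a b)) (trans (sym (∩-distribˡ-∪ Y (pts a) (pts b))) (⊆⇒∩≡ Y⊆)) (mulᵀ-open⁺ ya yb)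

copᵀ-counitˡ : ∀ {a : RawTopo n} → IsTopology a → Lift₂ _≈ᵀ_ (copᵀ ⊥ (pts a) a) (just (oneᵀ , a))
copᵀ-counitˡ t rewrite open≡true (Topology.pts-open t) = restrictᵀ-⊥ t , restrictᵀ-pts t

copᵀ-counitʳ : ∀ {a : RawTopo n} → IsTopology a → Lift₂ _≈ᵀ_ (copᵀ (pts a) ⊥ a) (just (a , oneᵀ))
copᵀ-counitʳ t rewrite open≡true (Topology.∅-open t) = restrictᵀ-pts t , restrictᵀ-⊥ t

copᵀ-oneᵀ : Lift₂ _≈ᵀ_ (copᵀ ⊥ ⊥ (oneᵀ {n})) (just (oneᵀ , oneᵀ))
copᵀ-oneᵀ = copᵀ-counitˡ oneᵀ-isTopology

module Coassociativity {a : RawTopo n} {X Y Z : Subset n} (t : IsTopology a) (X∩Z : Disj X Z)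
                       (cover : (X ∪ Y) ∪ Z ≡ pts a) where

  copˡ-condition⇒copʳ-condition : Open a Z → Open (restrictᵀ (X ∪ Y) a) Y →
                                  Open a (Y ∪ Z) × Open (restrictᵀ (Y ∪ Z) a) Z
  copˡ-condition⇒copʳ-condition z y =
    glue-open t z (⊆-reflexive (sym cover)) y ,
    subst (Open (restrictᵀ (Y ∪ Z) a)) (⊆⇒∩≡ (q⊆p∪q Y Z)) (restrictᵀ-open⁺ z)

  copʳ-condition⇒copˡ-condition : Open a (Y ∪ Z) → Open (restrictᵀ (Y ∪ Z) a) Z →
                                  Open a Z × Open (restrictᵀ (X ∪ Y) a) Y
  copʳ-condition⇒copˡ-condition yz z =
    open-in-open-subspace t yz z ,
    subst (Open (restrictᵀ (X ∪ Y) a))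
          (solve ((x₀ ∩ₑ x₂ , ∅ₑ) ∷ []) ((x₁ ∪ₑ x₂) ∩ₑ (x₀ ∪ₑ x₁) , x₁) refl (X ∷ Y ∷ Z ∷ []) (X∩Z ∷ []))
          (restrictᵀ-open⁺ yz)

  copᵀ-coassoc : Lift₃ _≈ᵀ_ (copˡ (Topo _) X Y Z a) (copʳ (Topo _) X Y Z a)
  copᵀ-coassoc with opens a Z in z | opens a (Y ∪ Z) in yz
  ... | true | true with opens (restrictᵀ (X ∪ Y) a) Y in y | opens (restrictᵀ (Y ∪ Z) a) Z in z′
  ...   | true  | true  =
    restrictᵀ-restrictᵀ a (p⊆p∪q Y) ,
    ≈ᵀ-trans (restrictᵀ-restrictᵀ a (q⊆p∪q X Y)) (≈ᵀ-sym (restrictᵀ-restrictᵀ a (p⊆p∪q Z))) ,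
    ≈ᵀ-sym (restrictᵀ-restrictᵀ a (q⊆p∪q Y Z))
  ...   | true  | false =
    contradictionᵇ (open≡true (proj₂ (copˡ-condition⇒copʳ-condition (mkOpen z) (mkOpen y)))) z′
  ...   | false | true  =
    contradictionᵇ (open≡true (proj₂ (copʳ-condition⇒copˡ-condition (mkOpen yz) (mkOpen z′)))) y
  ...   | false | false = tt
  copᵀ-coassoc | true | false with opens (restrictᵀ (X ∪ Y) a) Y in y
  ... | true  = contradictionᵇ (open≡true (proj₁ (copˡ-condition⇒copʳ-condition (mkOpen z) (mkOpen y)))) yz
  ... | false = tt
  copᵀ-coassoc | false | true with opens (restrictᵀ (Y ∪ Z) a) Z in z′
  ... | true  = contradictionᵇ (open≡true (proj₁ (copʳ-condition⇒copˡ-condition (mkOpen yz) (mkOpen z′)))) z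
  ... | false = tt
  copᵀ-coassoc | false | false = tt

copᵀ-mulᵀ : ∀ (a b : RawTopo n) X Y → IsTopology a → IsTopology b → Disj (pts a) (pts b) →
            Disj X Y → X ∪ Y ≡ pts a ∪ pts b →
            Lift₂ _≈ᵀ_ (copᵀ X Y (mulᵀ a b))
                       (combine (Topo n) (copᵀ (X ∩ pts a) (Y ∩ pts a) a) (copᵀ (X ∩ pts b) (Y ∩ pts b) b))
copᵀ-mulᵀ a b X Y ta tb disjoint _ cover
  with opens (mulᵀ a b) Y in y | opens a (Y ∩ pts a) in ya | opens b (Y ∩ pts b) in yb
... | true  | true  | true  = restrictᵀ-mulᵀ X ta tb , restrictᵀ-mulᵀ Y ta tb
... | true  | false | _     = contradictionᵇ (open≡true (proj₁ (mulᵀ-open-∩pts ta tb disjoint (mkOpen y)))) ya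
... | true  | true  | false = contradictionᵇ (open≡true (proj₂ (mulᵀ-open-∩pts ta tb disjoint (mkOpen y)))) yb
... | false | true  | true  = contradictionᵇ (open≡true (mulᵀ-open-split {a = a} {b} Y⊆ (mkOpen ya) (mkOpen yb))) y
  where
  Y⊆ : Y ⊆ pts a ∪ pts b
  Y⊆ = subst (Y ⊆_) cover (q⊆p∪q X Y)
... | false | false | _     = tt
... | false | true  | false = tt

Topo-isTwistedBialgebra : IsTwistedBialgebra (Topo n)
Topo-isTwistedBialgebra = record
  { one-valid     = oneᵀ-isTopology
  ; one-supp      = refl
  ; mul-valid     = λ _ _ ta tb disjoint → mulᵀ-isTopology ta tb disjoint , refl
  ; cop-valid     = copᵀ-isTopology
  ; relabel-valid = λ π _ t → relabelᵀ-isTopology π t , refl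
  ; relabel-id    = λ a _ → relabelᵀ-id a
  ; relabel-∘     = λ π σ a _ → relabelᵀ-∘ π σ a
  ; one-nat       = relabelᵀ-oneᵀ
  ; mul-nat       = λ π a b _ _ _ → relabelᵀ-mulᵀ π a b
  ; cop-nat       = λ π a X Y _ _ _ → copᵀ-relabelᵀ π a X Y
  ; mul-assoc     = λ a b c _ _ _ _ _ _ → mulᵀ-assoc a b c
  ; mul-unitˡ     = λ a _ → mulᵀ-identityˡ a
  ; mul-unitʳ     = λ a _ → mulᵀ-identityʳ a
  ; cop-coassoc   = λ _ _ _ _ t _ X∩Z _ cover → Coassociativity.copᵀ-coassoc t X∩Z cover
  ; cop-counitˡ   = λ _ → copᵀ-counitˡ
  ; cop-counitʳ   = λ _ → copᵀ-counitʳ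
  ; cop-one       = copᵀ-oneᵀ
  ; cop-mul       = copᵀ-mulᵀ
  }

-- Ideals of mixed graphs

record IsIdeal (G : RawGraph n) (I : Subset n) : Set where
  field
    ⊆V         : I ⊆ V G
    arc-closed : ∀ {x y} → x ∈ I → A G x y ≡ true → y ∈ I
open IsIdeal

isIdealᵇ⁺ : ∀ {G : RawGraph n} {I} → IsIdeal G I → isIdealᵇ G I ≡ true
isIdealᵇ⁺ {G = G} {I} ideal =
  ∧-true⁺ (⊆ᵇ⁺ (⊆V ideal)) (allFinᵇ⁺ λ x → allFinᵇ⁺ λ y → not∨-true⁺ {lookup I x ∧ A G x y} λ h →
    let x∈I , arc = ∧-true⁻ h in []=⇒lookup (arc-closed ideal (lookup⇒[]= x I x∈I) arc))

isIdealᵇ⁻ : ∀ {G : RawGraph n} {I} → isIdealᵇ G I ≡ true → IsIdeal G I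
isIdealᵇ⁻ {I = I} h = record
  { ⊆V         = ⊆ᵇ⁻ (proj₁ (∧-true⁻ h))
  ; arc-closed = λ {x} {y} x∈I arc → lookup⇒[]= y I
      (not∨-true⁻ (allFinᵇ⁻ (allFinᵇ⁻ (proj₂ (∧-true⁻ h)) x) y) (∧-true⁺ ([]=⇒lookup x∈I) arc))
  }

Υ-open⁺ : ∀ {G : RawGraph n} {I} → IsIdeal G I → Open (Υ G) I
Υ-open⁺ = mkOpen ∘ isIdealᵇ⁺

Υ-open⁻ : ∀ (G : RawGraph n) {I} → Open (Υ G) I → IsIdeal G I
Υ-open⁻ G = isIdealᵇ⁻ ∘ open≡true

arc-endpoints : ∀ {G : RawGraph n} {x y} → IsMixedGraph G → A G x y ≡ true → x ∈ V G × y ∈ V G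
arc-endpoints g arc = let x∈V , y∈V , _ = proj₁ (proj₂ (proj₂ g)) _ _ arc in x∈V , y∈V

⊥-isIdeal : ∀ {G : RawGraph n} → IsIdeal G ⊥
⊥-isIdeal = record { ⊆V = ⊥⊆ ; arc-closed = λ x∈⊥ _ → ⊥-elim (∉⊥ x∈⊥) }

V-isIdeal : ∀ {G : RawGraph n} → IsMixedGraph G → IsIdeal G (V G)
V-isIdeal g = record { ⊆V = ⊆-refl ; arc-closed = λ _ arc → proj₂ (arc-endpoints g arc) }

∪-isIdeal : ∀ {G : RawGraph n} {I J} → IsIdeal G I → IsIdeal G J → IsIdeal G (I ∪ J)
∪-isIdeal {I = I} {J} i j = record
  { ⊆V         = ∪-least (⊆V i) (⊆V j)
  ; arc-closed = λ x∈I∪J arc →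
      x∈p∪q⁺ (⊎-map (λ x∈I → arc-closed i x∈I arc) (λ x∈J → arc-closed j x∈J arc) (x∈p∪q⁻ I J x∈I∪J))
  }

∩-isIdeal : ∀ {G : RawGraph n} {I J} → IsIdeal G I → IsIdeal G J → IsIdeal G (I ∩ J)
∩-isIdeal {I = I} {J} i j = record
  { ⊆V         = ⊆-trans (p∩q⊆p I J) (⊆V i)
  ; arc-closed = λ x∈I∩J arc →
      let x∈I , x∈J = x∈p∩q⁻ I J x∈I∩J in x∈p∩q⁺ (arc-closed i x∈I arc , arc-closed j x∈J arc)
  }

image-isIdeal : ∀ (π : Permutation′ n) {G I} → IsIdeal G I → IsIdeal (relabelᴳ π G) (image π I)
image-isIdeal π i = record
  { ⊆V         = reindex-mono (⊆V i)
  ; arc-closed = λ x∈πI arc → ∈-reindex⁺ (arc-closed i (∈-reindex⁻ x∈πI) arc)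
  }

preimage-isIdeal : ∀ (π : Permutation′ n) {G S} → IsIdeal (relabelᴳ π G) S → IsIdeal G (preimage π S)
preimage-isIdeal π {G} s = record
  { ⊆V         = λ x∈ → subst (_∈ V G) (inverseˡ π) (∈-reindex⁻ (⊆V s (∈-reindex⁻ x∈)))
  ; arc-closed = λ x∈ arc → ∈-reindex⁺ (arc-closed s (∈-reindex⁻ x∈)
                   (subst₂ (λ u v → A G u v ≡ true) (sym (inverseˡ π)) (sym (inverseˡ π)) arc))
  }

subgraph-isIdeal : ∀ {G K : RawGraph n} {S} → IsMixedGraph G →
                   (∀ {x y} → A G x y ≡ true → A K x y ≡ true) → IsIdeal K S → IsIdeal G (S ∩ V G)
subgraph-isIdeal {S = S} g G⊆K s = record
  { ⊆V         = p∩q⊆q S _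
  ; arc-closed = λ x∈ arc →
      x∈p∩q⁺ (arc-closed s (proj₁ (x∈p∩q⁻ S _ x∈)) (G⊆K arc) , proj₂ (arc-endpoints g arc))
  }

mulᴳ-isIdeal : ∀ {G H : RawGraph n} {I J} → IsMixedGraph G → IsMixedGraph H → Disj (V G) (V H) →
               IsIdeal G I → IsIdeal H J → IsIdeal (mulᴳ G H) (I ∪ J)
mulᴳ-isIdeal {G = G} {H} {I} {J} g h disjoint i j = record { ⊆V = ∪-mono (⊆V i) (⊆V j) ; arc-closed = closed }
  where
  closed : ∀ {x y} → x ∈ I ∪ J → A G x y ∨ A H x y ≡ true → y ∈ I ∪ J
  closed x∈ arc with x∈p∪q⁻ I J x∈ | ∨-true⁻ arc
  ... | inj₁ x∈I | inj₁ G-arc = x∈p∪q⁺ (inj₁ (arc-closed i x∈I G-arc))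
  ... | inj₂ x∈J | inj₂ H-arc = x∈p∪q⁺ (inj₂ (arc-closed j x∈J H-arc))
  ... | inj₁ x∈I | inj₂ H-arc = ⊥-elim (∈-disjoint disjoint (⊆V i x∈I) (proj₁ (arc-endpoints h H-arc)))
  ... | inj₂ x∈J | inj₁ G-arc = ⊥-elim (∈-disjoint disjoint (proj₁ (arc-endpoints g G-arc)) (⊆V j x∈J))

restrictᴳ-arc : ∀ {G : RawGraph n} {Z x y} → A G x y ≡ true → x ∈ Z → y ∈ Z → A (restrictᴳ Z G) x y ≡ true
restrictᴳ-arc arc x∈Z y∈Z = ∧-true⁺ arc (∧-true⁺ ([]=⇒lookup x∈Z) ([]=⇒lookup y∈Z))

restrictᴳ-isIdeal : ∀ {G : RawGraph n} {Z O} → IsIdeal G O → IsIdeal (restrictᴳ Z G) (O ∩ Z)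
restrictᴳ-isIdeal {Z = Z} {O} o = record
  { ⊆V         = ∩-mono (⊆V o) ⊆-refl
  ; arc-closed = λ {_} {y} x∈ arc →
      let G-arc , ends∈Z = ∧-true⁻ arc in
      x∈p∩q⁺ (arc-closed o (proj₁ (x∈p∩q⁻ O Z x∈)) G-arc , lookup⇒[]= y Z (proj₂ (∧-true⁻ ends∈Z)))
  }

ideal-extend : ∀ {G : RawGraph n} {X Y S} → IsMixedGraph G → IsIdeal G Y → V G ⊆ X ∪ Y →
               IsIdeal (restrictᴳ X G) S → IsIdeal G (S ∪ Y)
ideal-extend {G = G} {X} {Y} {S} g y cover s =
  record { ⊆V = ∪-least (proj₁ ∘ x∈p∩q⁻ (V G) X ∘ ⊆V s) (⊆V y) ; arc-closed = closed }
  where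
  closed : ∀ {u v} → u ∈ S ∪ Y → A G u v ≡ true → v ∈ S ∪ Y
  closed u∈ arc with x∈p∪q⁻ S Y u∈
  ... | inj₂ u∈Y = x∈p∪q⁺ (inj₂ (arc-closed y u∈Y arc))
  ... | inj₁ u∈S with x∈p∪q⁻ X Y (cover (proj₂ (arc-endpoints g arc)))
  ...   | inj₂ v∈Y = x∈p∪q⁺ (inj₂ v∈Y)
  ...   | inj₁ v∈X = x∈p∪q⁺ (inj₁ (arc-closed s u∈S (restrictᴳ-arc {G = G} arc u∈X v∈X)))
    where u∈X = proj₂ (x∈p∩q⁻ (V G) X (⊆V s u∈S))

ideal-of-ideal : ∀ {G : RawGraph n} {Y S} → IsIdeal G Y → IsIdeal (restrictᴳ Y G) S → IsIdeal G S
ideal-of-ideal {G = G} {Y} y s = record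
  { ⊆V         = proj₁ ∘ x∈p∩q⁻ (V G) Y ∘ ⊆V s
  ; arc-closed = λ x∈S arc → let x∈Y = proj₂ (x∈p∩q⁻ (V G) Y (⊆V s x∈S)) in
      arc-closed s x∈S (restrictᴳ-arc {G = G} arc x∈Y (arc-closed y x∈Y arc))
  }

-- The morphism Υ

Υ-isTopology : ∀ {G : RawGraph n} → IsMixedGraph G → IsTopology (Υ G)
Υ-isTopology {G = G} g =
  isTopology (⊆V ∘ Υ-open⁻ G) (Υ-open⁺ (⊥-isIdeal {G = G})) (Υ-open⁺ (V-isIdeal g))
             (λ o o′ → Υ-open⁺ (∪-isIdeal (Υ-open⁻ G o) (Υ-open⁻ G o′)))
             (λ o o′ → Υ-open⁺ (∩-isIdeal (Υ-open⁻ G o) (Υ-open⁻ G o′)))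

Υ-relabel : ∀ (π : Permutation′ n) G → Υ (relabelᴳ π G) ≈ᵀ relabelᵀ π (Υ G)
Υ-relabel π G = ≈ᵀ-intro refl to from
  where
  to : ∀ {S} → Open (Υ (relabelᴳ π G)) S → Open (relabelᵀ π (Υ G)) S
  to o = relabelᵀ-open⁺ π (Υ-open⁺ (preimage-isIdeal π {G} (Υ-open⁻ (relabelᴳ π G) o)))
  from : ∀ {S} → Open (relabelᵀ π (Υ G)) S → Open (Υ (relabelᴳ π G)) S
  from {S} o = Υ-open⁺ (subst (IsIdeal (relabelᴳ π G)) (image-preimage π S)
                              (image-isIdeal π (Υ-open⁻ G (relabelᵀ-open⁻ π (Υ G) o))))

Υ-one : Υ (oneᴳ {n}) ≈ᵀ oneᵀ
Υ-one = ≈ᵀ-intro refl (λ o → oneᵀ-open⁺ (⊆-antisym (⊆V (Υ-open⁻ oneᴳ o)) ⊥⊆))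
                      (λ o → subst (Open (Υ oneᴳ)) (sym (oneᵀ-open⁻ o)) (Υ-open⁺ (⊥-isIdeal {G = oneᴳ})))

Υ-mul : ∀ {G H : RawGraph n} → IsMixedGraph G → IsMixedGraph H → Disj (V G) (V H) →
        Υ (mulᴳ G H) ≈ᵀ mulᵀ (Υ G) (Υ H)
Υ-mul {G = G} {H} g h disjoint = ≈ᵀ-intro refl to from
  where
  G-arc : ∀ {x y} → A G x y ≡ true → A G x y ∨ A H x y ≡ true
  G-arc {x} {y} = cong (_∨ A H x y)
  H-arc : ∀ {x y} → A H x y ≡ true → A G x y ∨ A H x y ≡ true
  H-arc {x} {y} arc = trans (cong (A G x y ∨_) arc) (∨-zeroʳ _)
  to : ∀ {S} → Open (Υ (mulᴳ G H)) S → Open (mulᵀ (Υ G) (Υ H)) S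
  to o = let s = Υ-open⁻ (mulᴳ G H) o in
    mulᵀ-open-split (⊆V s) (Υ-open⁺ (subgraph-isIdeal g G-arc s)) (Υ-open⁺ (subgraph-isIdeal h H-arc s))
  from : ∀ {S} → Open (mulᵀ (Υ G) (Υ H)) S → Open (Υ (mulᴳ G H)) S
  from o with mulᵀ-open⁻ (Υ G) (Υ H) o
  ... | I , J , i , j , refl = Υ-open⁺ (mulᴳ-isIdeal g h disjoint (Υ-open⁻ G i) (Υ-open⁻ H j))

restrictᵀ-Υ-open : ∀ {G : RawGraph n} {Z S} → Open (restrictᵀ Z (Υ G)) S → Open (Υ (restrictᴳ Z G)) S
restrictᵀ-Υ-open {G = G} h with restrictᵀ-open⁻ h
... | O , o , refl = Υ-open⁺ (restrictᴳ-isIdeal (Υ-open⁻ G o))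

Υ-cop : ∀ {G : RawGraph n} {X Y} → IsMixedGraph G → Disj X Y → X ∪ Y ≡ V G →
        Lift₂ _≈ᵀ_ (copᵀ X Y (Υ G)) (mapᴹ (λ { (b , c) → (Υ b , Υ c) }) (copᴳ X Y G))
Υ-cop {G = G} {X} {Y} g X∩Y cover with isIdealᵇ G Y in Y-ideal
... | true  = ≈ᵀ-intro refl (restrictᵀ-Υ-open {G = G}) X-from , ≈ᵀ-intro refl (restrictᵀ-Υ-open {G = G}) Y-from
  where
  y : IsIdeal G Y
  y = isIdealᵇ⁻ Y-ideal
  X-from : ∀ {S} → Open (Υ (restrictᴳ X G)) S → Open (restrictᵀ X (Υ G)) S
  X-from {S} o = let s = Υ-open⁻ (restrictᴳ X G) o in
    subst (Open (restrictᵀ X (Υ G)))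
          (solve ((x₀ ∩ₑ (x₁ ∩ₑ x₂) , x₀) ∷ (x₂ ∩ₑ x₃ , ∅ₑ) ∷ []) ((x₀ ∪ₑ x₃) ∩ₑ x₂ , x₀) refl
                 (S ∷ V G ∷ X ∷ Y ∷ []) (⊆⇒∩≡ (⊆V s) ∷ X∩Y ∷ []))
          (restrictᵀ-open⁺ (Υ-open⁺ (ideal-extend g y (⊆-reflexive (sym cover)) s)))
  Y-from : ∀ {S} → Open (Υ (restrictᴳ Y G)) S → Open (restrictᵀ Y (Υ G)) S
  Y-from o = let s = Υ-open⁻ (restrictᴳ Y G) o in
    subst (Open (restrictᵀ Y (Υ G))) (⊆⇒∩≡ (proj₂ ∘ x∈p∩q⁻ (V G) Y ∘ ⊆V s))
          (restrictᵀ-open⁺ (Υ-open⁺ (ideal-of-ideal y s)))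
... | false = tt

Υ-isMorphism : IsMorphism (Gr n) (Topo n) Υ
Υ-isMorphism = record
  { f-valid   = λ _ g → Υ-isTopology g , refl
  ; f-relabel = λ π G _ → Υ-relabel π G
  ; f-one     = Υ-one
  ; f-mul     = λ _ _ → Υ-mul
  ; f-cop     = λ _ _ _ → Υ-cop
  }

-- Minimal open neighbourhoods

⋂ˢ : (Subset m → Subset n) → Subset n
⋂ˢ {m = ℕ.zero}  f = f []
⋂ˢ {m = ℕ.suc m} f = ⋂ˢ (f ∘ (true ∷_)) ∩ ⋂ˢ (f ∘ (false ∷_))

⋂ˢ-⊆ : ∀ (f : Subset m → Subset n) S → ⋂ˢ f ⊆ f S
⋂ˢ-⊆ f []          = ⊆-refl
⋂ˢ-⊆ f (true ∷ S)  = ⊆-trans (p∩q⊆p _ _) (⋂ˢ-⊆ (f ∘ (true ∷_)) S)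
⋂ˢ-⊆ f (false ∷ S) = ⊆-trans (p∩q⊆q _ _) (⋂ˢ-⊆ (f ∘ (false ∷_)) S)

⋂ˢ-closed : ∀ (P : Subset n → Set) → (∀ {R U} → P R → P U → P (R ∩ U)) →
            {f : Subset m → Subset n} → (∀ S → P (f S)) → P (⋂ˢ f)
⋂ˢ-closed {m = ℕ.zero}  P ∩-closed h = h []
⋂ˢ-closed {m = ℕ.suc m} P ∩-closed h =
  ∩-closed (⋂ˢ-closed P ∩-closed (h ∘ (true ∷_))) (⋂ˢ-closed P ∩-closed (h ∘ (false ∷_)))

⋃ᶠ : (Fin m → Subset n) → Subset n
⋃ᶠ {m = ℕ.zero}  f = ⊥
⋃ᶠ {m = ℕ.suc m} f = f zero ∪ ⋃ᶠ (f ∘ suc)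

⊆-⋃ᶠ : ∀ (f : Fin m → Subset n) x → f x ⊆ ⋃ᶠ f
⊆-⋃ᶠ f zero    = p⊆p∪q _
⊆-⋃ᶠ f (suc x) = ⊆-trans (⊆-⋃ᶠ (f ∘ suc) x) (q⊆p∪q (f zero) _)

⋃ᶠ-least : ∀ {f : Fin m → Subset n} {S} → (∀ x → f x ⊆ S) → ⋃ᶠ f ⊆ S
⋃ᶠ-least {m = ℕ.zero}  _ = ⊥⊆
⋃ᶠ-least {m = ℕ.suc m} h = ∪-least (h zero) (⋃ᶠ-least (h ∘ suc))

⋃ᶠ-closed : ∀ (P : Subset n → Set) → P ⊥ → (∀ {R U} → P R → P U → P (R ∪ U)) →
            {f : Fin m → Subset n} → (∀ x → P (f x)) → P (⋃ᶠ f)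
⋃ᶠ-closed {m = ℕ.zero}  P ∅ ∪-closed h = ∅
⋃ᶠ-closed {m = ℕ.suc m} P ∅ ∪-closed h = ∪-closed (h zero) (⋃ᶠ-closed P ∅ ∪-closed (h ∘ suc))

module MinimalNeighbourhood {T : RawTopo n} (t : IsTopology T) where
  open Topology t

  -- ⋂ of the open sets containing x; every other subset contributes the neutral pts T.
  nbhd : Fin n → Subset n
  nbhd x = ⋂ˢ (λ O → if opens T O ∧ lookup O x then O else pts T)

  nbhd-open : ∀ x → Open T (nbhd x)
  nbhd-open x = ⋂ˢ-closed (Open T) ∩-open candidate-open
    where
    candidate-open : ∀ O → Open T (if opens T O ∧ lookup O x then O else pts T)
    candidate-open O with opens T O ∧ lookup O x in e
    ... | true  = mkOpen (proj₁ (∧-true⁻ e))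
    ... | false = pts-open

  ∈-nbhd : ∀ {x} → x ∈ pts T → x ∈ nbhd x
  ∈-nbhd {x} x∈P = ⋂ˢ-closed (x ∈_) (λ x∈R x∈U → x∈p∩q⁺ (x∈R , x∈U)) candidate-∋
    where
    candidate-∋ : ∀ O → x ∈ (if opens T O ∧ lookup O x then O else pts T)
    candidate-∋ O with opens T O ∧ lookup O x in e
    ... | true  = lookup⇒[]= x O (proj₂ (∧-true⁻ e))
    ... | false = x∈P

  nbhd-least : ∀ {x O} → Open T O → x ∈ O → nbhd x ⊆ O
  nbhd-least {x} {O} o x∈O =
    subst (nbhd x ⊆_) (cong (λ b → if b then O else pts T) (∧-true⁺ (open≡true o) ([]=⇒lookup x∈O)))
          (⋂ˢ-⊆ _ O)

  -- S is the union of the minimal neighbourhoods of its points.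
  nbhd-closed⇒open : ∀ {S} → S ⊆ pts T → (∀ {x} → x ∈ S → nbhd x ⊆ S) → Open T S
  nbhd-closed⇒open {S} S⊆P closed =
    subst (Open T) (⊆-antisym (⋃ᶠ-least piece-⊆) S⊆⋃) (⋃ᶠ-closed (Open T) ∅-open ∪-open piece-open)
    where
    piece : Fin n → Subset n
    piece x = if lookup S x then nbhd x else ⊥
    piece-open : ∀ x → Open T (piece x)
    piece-open x with lookup S x
    ... | true  = nbhd-open x
    ... | false = ∅-open
    piece-⊆ : ∀ x → piece x ⊆ S
    piece-⊆ x with lookup S x in e
    ... | true  = closed (lookup⇒[]= x S e)
    ... | false = ⊥⊆
    S⊆⋃ : S ⊆ ⋃ᶠ piece
    S⊆⋃ {x} x∈S = ⊆-⋃ᶠ piece x (subst (λ b → x ∈ (if b then nbhd x else ⊥)) (sym ([]=⇒lookup x∈S))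
                                       (∈-nbhd (S⊆P x∈S)))

  specialisation : RawGraph n
  specialisation = record
    { V = pts T
    ; E = λ _ _ → false
    ; A = λ x y → lookup (pts T) x ∧ lookup (nbhd x) y ∧ not (does (x ≟ y))
    }

  specialisation-isMixedGraph : IsMixedGraph specialisation
  specialisation-isMixedGraph = (λ _ _ → refl) , (λ _ _ ()) , arc-valid , (λ _ _ ())
    where
    arc-valid : ∀ x y → A specialisation x y ≡ true → x ∈ pts T × y ∈ pts T × x ≢ y
    arc-valid x y arc =
      let x∈P , rest = ∧-true⁻ arc ; y∈Ux , x≢y = ∧-true⁻ rest in
      lookup⇒[]= x _ x∈P , open-⊆ (nbhd-open x) (lookup⇒[]= y _ y∈Ux) ,
      λ x≡y → contradictionᵇ x≢y (cong not (dec-true (x ≟ y) x≡y))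

  Υ-specialisation : Υ specialisation ≈ᵀ T
  Υ-specialisation = ≈ᵀ-intro refl to from
    where
    to : ∀ {S} → Open (Υ specialisation) S → Open T S
    to {S} o = nbhd-closed⇒open (⊆V s) closed
      where
      s = Υ-open⁻ specialisation o
      closed : ∀ {x} → x ∈ S → nbhd x ⊆ S
      closed {x} x∈S {y} y∈Ux with x ≟ y
      ... | yes refl = x∈S
      ... | no x≢y   = arc-closed s x∈S (∧-true⁺ {lookup (pts T) x} ([]=⇒lookup (⊆V s x∈S))
                                         (∧-true⁺ ([]=⇒lookup y∈Ux) (cong not (dec-false (x ≟ y) x≢y))))
    from : ∀ {S} → Open T S → Open (Υ specialisation) S
    from o = Υ-open⁺ {G = specialisation} (record
      { ⊆V         = open-⊆ o
      ; arc-closed = λ {x} {y} x∈S arc →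
          nbhd-least o x∈S (lookup⇒[]= y _ (proj₁ (∧-true⁻ (proj₂ (∧-true⁻ {lookup (pts T) x} arc)))))
      })

Υ-surjective : IsSurjective (Gr n) (Topo n) Υ
Υ-surjective _ t = specialisation , specialisation-isMixedGraph , Υ-specialisation
  where open MinimalNeighbourhood t

proposition2p3 : (n : ℕ) →
    IsTwistedBialgebra (Topo n) × IsMorphism (Gr n) (Topo n) Υ × IsSurjective (Gr n) (Topo n) Υ
proposition2p3 n = Topo-isTwistedBialgebra , Υ-isMorphism , Υ-surjective
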